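{- Let $k \geq 3$. Then $$g_1(k, k-2) \leq \left\lceil \frac{k^2}{4} \right\rceil = \begin{cases} \frac{1}{4}(k^2+3), & k \text{ odd},\\ \frac{1}{4}k^2, & k \text{ even};\end{cases}$$ that is, every finite $k$-uniform hypergraph $H$ with $\nu^{(k-2)}(H) = 1$ satisfies $\tau^{(k-2)}(H) \leq \lceil k^2/4 \rceil$.
   Context: For a $k$-uniform hypergraph $H$ with vertex set $V$ and $1 \le m \le k-1$: an $m$-matching of $H$ is a set $M$ of edges with $|e \cap e'| < m$ for all distinct $e, e' \in M$; $\nu^{(m)}(H)$ is the maximum size of an $m$-matching. An $m$-cover is a set $C \subseteq \binom{V}{m}$ such that every edge of $H$ contains some member of $C$; $\tau^{(m)}(H)$ is the minimum size of an $m$-cover. $g_1(k,m)$ is the supremum of $\tau^{(m)}(H)/\nu^{(m)}(H)$ over all finite $k$-uniform hypergraphs $H$ with $\nu^{(m)}(H) = 1$. -}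

module Defs where

open import Data.Nat using (ℕ; _+_; _*_; _≤_; _<_; _/_)
open import Data.Fin.Subset using (Subset; _⊆_; _∩_; ∣_∣)
open import Data.List using (List; length)
open import Data.List.Membership.Propositional using (_∈_)
open import Data.List.Relation.Unary.All using (All)
open import Data.List.Relation.Unary.Any using (Any)
open import Data.List.Relation.Unary.Unique.Propositional using (Unique)
open import Data.List.Relation.Unary.AllPairs using (AllPairs)
open import Data.Product using (Σ; _×_)
open import Relation.Binary.PropositionalEquality using (_≡_)

-- A finite k-uniform hypergraph on the vertex set Fin n:
-- a finite list of edges, each edge a k-element subset of Fin n.
-- (Repeated entries in the list represent the same edge; all notions below
-- only depend on the underlying set of edges.)
record Hypergraph (n k : ℕ) : Set where
  field
    edges   : List (Subset n)
    uniform : All (λ e → ∣ e ∣ ≡ k) edges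
open Hypergraph public

record IsMatching {n k : ℕ} (m : ℕ) (H : Hypergraph n k) (M : List (Subset n)) : Set where
  field
    inH      : All (λ e → e ∈ edges H) M
    distinct : Unique M
    small    : AllPairs (λ e e′ → ∣ e ∩ e′ ∣ < m) M

ν≡1 : {n k : ℕ} (m : ℕ) (H : Hypergraph n k) → Set
ν≡1 m H =
  Σ (List _) (λ M → IsMatching m H M × length M ≡ 1)
  × (∀ M → IsMatching m H M → length M ≤ 1)

record IsCover {n k : ℕ} (m : ℕ) (H : Hypergraph n k) (C : List (Subset n)) : Set where
  field
    msets  : All (λ c → ∣ c ∣ ≡ m) C
    covers : All (λ e → Any (λ c → c ⊆ e) C) (edges H)

τ≤ : {n k : ℕ} (m : ℕ) (H : Hypergraph n k) (t : ℕ) → Set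
τ≤ m H t = Σ (List _) (λ C → IsCover m H C × length C ≤ t)

ceilSq/4 : ℕ → ℕ
ceilSq/4 k = (k * k + 3) / 4

{-# OPTIONS --safe #-}
module Submission where

-- Maximality of a single (k−2)-matching means that any two edges share at least k − 2 vertices,
-- so an edge misses at most two vertices of any other edge.  Fix an edge e₀.  For k ≥ 4 there
-- are u ≠ v in e₀ and at most k − 1 sets of size k − 2, each a subset of e₀ enlarged by at most
-- one further vertex, covering every edge that misses u or v.  The edges through both u and v
-- form, after deleting u and v, a (k−2)-uniform family with the same intersection property;
-- by induction it is covered by ⌈(k−2)²/4⌉ sets of size k − 4, and adding u and v to these
-- covers the remaining edges.  In total (k − 1) + ⌈(k−2)²/4⌉ = ⌈k²/4⌉.  The bases are k = 2
-- (the empty set) and k = 3 (the singletons of e₀).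

open import Defs
open import Data.Nat using (ℕ; zero; suc; _+_; _*_; _∸_; _≤_; _<_; _/_; _≤?_; s≤s; z≤n)
open import Data.Nat.Properties
  using (≤-refl; ≤-trans; ≤-reflexive; suc-injective; +-comm; +-monoʳ-≤; +-mono-≤;
         +-cancelˡ-≡; +-cancelˡ-≤; 1+n≰n; m∸n≤m; ≰⇒>; module ≤-Reasoning)
open import Data.Nat.DivMod using (+-distrib-/-∣ʳ; m*n/n≡m)
open import Data.Nat.Divisibility using (divides)
open import Data.Nat.Tactic.RingSolver using (solve-∀)
open import Data.Bool using () renaming (_≟_ to _≟ᵇ_)
open import Data.Vec using ([]; _∷_; here; there)
open import Data.Vec.Properties using (≡-dec)
open import Data.Fin using (Fin; zero; suc; _≟_)
open import Data.Fin.Properties using (any?)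
open import Data.Fin.Subset
  using (Subset; inside; outside; ∣_∣; _∈_; _∉_; _⊆_; _∩_; _∪_; _-_; ⁅_⁆; Nonempty)
  renaming (⊥ to ∅)
open import Data.Fin.Subset.Properties
  using (_∈?_; ⊆-trans; ⊆-min; p∩q⊆p; x∈p∩q⁺; x∈p∩q⁻; x∈p∪q⁻; p─q⊆p; p─⊥≡p; ∪-identityʳ;
         x∈p∧x≢y⇒x∈p-y; p─x─y≡p─y─x; x∈⁅y⁆⇒x≡y; ∣⁅x⁆∣≡1; ∣⊥∣≡0; p⊆q⇒∣p∣≤∣q∣; ∩-idem)
open import Data.List using (List; []; _∷_; length; _++_; map; filter)
open import Data.List.Properties using (length-++; length-map; length-filter)
open import Data.List.Membership.Propositional using (find; lose) renaming (_∈_ to _∈L_)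
open import Data.List.Membership.Propositional.Properties using (∈-map⁺; ∈-map⁻; ∈-filter⁺; ∈-filter⁻)
open import Data.List.Relation.Unary.All as All using (All; []; _∷_)
open import Data.List.Relation.Unary.All.Properties using (++⁺)
open import Data.List.Relation.Unary.Any as Any using (Any; here; there)
open import Data.List.Relation.Unary.Any.Properties using (++⁺ˡ; ++⁺ʳ)
open import Data.List.Relation.Unary.AllPairs using ([]; _∷_)
open import Data.Product using (Σ; ∃; _×_; _,_; proj₁; proj₂)
open import Data.Sum using (_⊎_; inj₁; inj₂)
open import Data.Empty using (⊥-elim)
open import Function using (_∘_)
open import Relation.Binary.PropositionalEquality
  using (_≡_; _≢_; refl; sym; trans; cong; subst; ≢-sym; module ≡-Reasoning)
open import Relation.Nullary using (¬_; Dec; yes; no; ¬?)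
open import Relation.Nullary.Decidable using (_×-dec_; decidable-stable)

private
  variable
    n : ℕ
    p q : Subset n
    x y z : Fin n

suc∣p-x∣≡∣p∣ : x ∈ p → suc ∣ p - x ∣ ≡ ∣ p ∣
suc∣p-x∣≡∣p∣ {x = zero}  {inside ∷ p}  here        = cong (suc ∘ ∣_∣) (p─⊥≡p p)
suc∣p-x∣≡∣p∣ {x = suc x} {inside ∷ p}  (there x∈p) = cong suc (suc∣p-x∣≡∣p∣ x∈p)
suc∣p-x∣≡∣p∣ {x = suc x} {outside ∷ p} (there x∈p) = suc∣p-x∣≡∣p∣ x∈p

2+∣p-x-y∣≡∣p∣ : x ∈ p → y ∈ p - x → 2 + ∣ p - x - y ∣ ≡ ∣ p ∣
2+∣p-x-y∣≡∣p∣ x∈p y∈p-x = trans (cong suc (suc∣p-x∣≡∣p∣ y∈p-x)) (suc∣p-x∣≡∣p∣ x∈p)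

3+∣p-x-y-z∣≡∣p∣ : x ∈ p → y ∈ p - x → z ∈ p - x - y → 3 + ∣ p - x - y - z ∣ ≡ ∣ p ∣
3+∣p-x-y-z∣≡∣p∣ x∈p y∈p-x z∈p-x-y =
  trans (cong (2 +_) (suc∣p-x∣≡∣p∣ z∈p-x-y)) (2+∣p-x-y∣≡∣p∣ x∈p y∈p-x)

∣p∪⁅x⁆∣≡suc∣p∣ : x ∉ p → ∣ p ∪ ⁅ x ⁆ ∣ ≡ suc ∣ p ∣
∣p∪⁅x⁆∣≡suc∣p∣ {x = zero}  {outside ∷ p} _   = cong (suc ∘ ∣_∣) (∪-identityʳ p)
∣p∪⁅x⁆∣≡suc∣p∣ {x = zero}  {inside ∷ p}  x∉p = ⊥-elim (x∉p here)
∣p∪⁅x⁆∣≡suc∣p∣ {x = suc x} {inside ∷ p}  x∉p = cong suc (∣p∪⁅x⁆∣≡suc∣p∣ (x∉p ∘ there))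
∣p∪⁅x⁆∣≡suc∣p∣ {x = suc x} {outside ∷ p} x∉p = ∣p∪⁅x⁆∣≡suc∣p∣ (x∉p ∘ there)

x∈p-y⇒x∈p : x ∈ p - y → x ∈ p
x∈p-y⇒x∈p {p = p} {y = y} = p─q⊆p p ⁅ y ⁆

x∉p-x : x ∉ p - x
x∉p-x {x = zero}  {inside ∷ p}  ()
x∉p-x {x = zero}  {outside ∷ p} ()
x∉p-x {x = suc x} {_ ∷ p}       (there x∈p-x) = x∉p-x x∈p-x

x∈p-y⇒x≢y : x ∈ p - y → x ≢ y
x∈p-y⇒x≢y x∈p-x refl = x∉p-x x∈p-x

x∉p∧y∈p⇒x≢y : x ∉ p → y ∈ p → x ≢ y
x∉p∧y∈p⇒x≢y x∉p y∈p refl = x∉p y∈p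

x∉q⇒x∉p∩q : x ∉ q → x ∉ p ∩ q
x∉q⇒x∉p∩q {q = q} {p = p} x∉q x∈p∩q = x∉q (proj₂ (x∈p∩q⁻ p q x∈p∩q))

x∉p⇒x∉p∩q : x ∉ p → x ∉ p ∩ q
x∉p⇒x∉p∩q {p = p} {q = q} x∉p x∈p∩q = x∉p (proj₁ (x∈p∩q⁻ p q x∈p∩q))

p⊆q∧x∉p⇒p⊆q-x : p ⊆ q → x ∉ p → p ⊆ q - x
p⊆q∧x∉p⇒p⊆q-x p⊆q x∉p y∈p = x∈p∧x≢y⇒x∈p-y (p⊆q y∈p) (λ { refl → x∉p y∈p })

p⊆q⇒p-x⊆q-x : p ⊆ q → p - x ⊆ q - x
p⊆q⇒p-x⊆q-x p⊆q y∈p-x = x∈p∧x≢y⇒x∈p-y (p⊆q (x∈p-y⇒x∈p y∈p-x)) (x∈p-y⇒x≢y y∈p-x)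

x∈p⇒⁅x⁆⊆p : x ∈ p → ⁅ x ⁆ ⊆ p
x∈p⇒⁅x⁆⊆p {x = x} {p = p} x∈p y∈⁅x⁆ = subst (_∈ p) (sym (x∈⁅y⁆⇒x≡y x y∈⁅x⁆)) x∈p

p∪⁅x⁆⊆q : p ⊆ q → x ∈ q → p ∪ ⁅ x ⁆ ⊆ q
p∪⁅x⁆⊆q {p = p} {x = x} p⊆q x∈q y∈p∪⁅x⁆ with x∈p∪q⁻ p ⁅ x ⁆ y∈p∪⁅x⁆
... | inj₁ y∈p    = p⊆q y∈p
... | inj₂ y∈⁅x⁆ = x∈p⇒⁅x⁆⊆p x∈q y∈⁅x⁆

p-x⊆q∧x∈q⇒p⊆q : p - x ⊆ q → x ∈ q → p ⊆ q
p-x⊆q∧x∈q⇒p⊆q {x = x} {q = q} p-x⊆q x∈q {y} y∈p with y ≟ x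
... | yes refl = x∈q
... | no  y≢x  = p-x⊆q (x∈p∧x≢y⇒x∈p-y y∈p y≢x)

⊆⊎⊈ : (p q : Subset n) → p ⊆ q ⊎ ∃ λ x → x ∈ p × x ∉ q
⊆⊎⊈ p q with any? (λ x → x ∈? p ×-dec ¬? (x ∈? q))
... | yes witness = inj₂ witness
... | no  none    = inj₁ (λ {x} x∈p → decidable-stable (x ∈? q) (λ x∉q → none (x , x∈p , x∉q)))

nonempty : (p : Subset n) → 0 < ∣ p ∣ → Nonempty p
nonempty (inside ∷ p)  _       = zero , here
nonempty (outside ∷ p) 0<∣p∣ with nonempty p 0<∣p∣
... | x , x∈p = suc x , there x∈p

finite-choice : {B : Set} (Q : B → Set) (P : Fin n → B → Set) (p : Subset n) →
  (∀ {x} → x ∈ p → Σ B (λ b → Q b × P x b)) →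
  Σ (List B) (λ bs → All Q bs × length bs ≤ ∣ p ∣ × (∀ {x} → x ∈ p → Any (P x) bs))
finite-choice Q P [] choose = [] , [] , z≤n , λ ()
finite-choice Q P (outside ∷ p) choose
  with bs , Qbs , ∣bs∣≤∣p∣ , covered ← finite-choice Q (P ∘ suc) p (choose ∘ there) =
  bs , Qbs , ∣bs∣≤∣p∣ , λ { (there x∈p) → covered x∈p }
finite-choice Q P (inside ∷ p) choose
  with bs , Qbs , ∣bs∣≤∣p∣ , covered ← finite-choice Q (P ∘ suc) p (choose ∘ there)
     | b , Qb , Pb ← choose here =
  b ∷ bs , Qb ∷ Qbs , s≤s ∣bs∣≤∣p∣ , λ { here → here Pb ; (there x∈p) → there (covered x∈p) }

Intersecting : ∀ {k} → ℕ → Hypergraph n k → Set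
Intersecting t H = ∀ {f g} → f ∈L edges H → g ∈L edges H → t ≤ ∣ f ∩ g ∣

module Intersecting-k∸2 {k} {H : Hypergraph n k} (meet : Intersecting (k ∸ 2) H) where

  ∣edge∣ : ∀ {f} → f ∈L edges H → ∣ f ∣ ≡ k
  ∣edge∣ = All.lookup (uniform H)

  ∩⊈-three-removed : ∀ {e f g a b c} → f ∈L edges H → g ∈L edges H → ∣ e ∣ ≡ k →
                     a ∈ e → b ∈ e - a → c ∈ e - a - b → ¬ (f ∩ g ⊆ e - a - b - c)
  ∩⊈-three-removed {e} {f} {g} {a} {b} {c} f∈E g∈E ∣e∣≡k a∈e b∈e-a c∈e-a-b f∩g⊆ =
    1+n≰n (subst (λ k → k ∸ 2 ≤ ∣ e - a - b - c ∣) (sym 3+∣e-a-b-c∣≡k) k∸2≤∣e-a-b-c∣)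
    where
    3+∣e-a-b-c∣≡k : 3 + ∣ e - a - b - c ∣ ≡ k
    3+∣e-a-b-c∣≡k = trans (3+∣p-x-y-z∣≡∣p∣ a∈e b∈e-a c∈e-a-b) ∣e∣≡k
    k∸2≤∣e-a-b-c∣ : k ∸ 2 ≤ ∣ e - a - b - c ∣
    k∸2≤∣e-a-b-c∣ = ≤-trans (meet f∈E g∈E) (p⊆q⇒∣p∣≤∣q∣ f∩g⊆)

  missing-two⇒rest⊆ : ∀ {e f a b} → e ∈L edges H → f ∈L edges H →
                       a ∈ e → b ∈ e - a → a ∉ f → b ∉ f → e - a - b ⊆ f
  missing-two⇒rest⊆ {e} {f} e∈E f∈E a∈e b∈e-a a∉f b∉f {c} c∈e-a-b with c ∈? f
  ... | yes c∈f = c∈f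
  ... | no  c∉f = ⊥-elim (∩⊈-three-removed e∈E f∈E (∣edge∣ e∈E) a∈e b∈e-a c∈e-a-b
                    (p⊆q∧x∉p⇒p⊆q-x (p⊆q∧x∉p⇒p⊆q-x (p⊆q∧x∉p⇒p⊆q-x (p∩q⊆p e f)
                      (x∉q⇒x∉p∩q a∉f)) (x∉q⇒x∉p∩q b∉f)) (x∉q⇒x∉p∩q c∉f)))

  common-point-outside : ∀ {e f g a b c} → f ∈L edges H → g ∈L edges H → ∣ e ∣ ≡ k →
                         a ∈ e → b ∈ e - a → c ∈ e - a - b → b ∉ f → c ∉ f → a ∉ g →
                         ∃ λ x → x ∉ e × x ∈ f × x ∈ g
  common-point-outside {e} {f} {g} f∈E g∈E ∣e∣≡k a∈e b∈e-a c∈e-a-b b∉f c∉f a∉g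
    with any? (λ x → ¬? (x ∈? e) ×-dec x ∈? f ×-dec x ∈? g)
  ... | yes found = found
  ... | no  none  = ⊥-elim (∩⊈-three-removed f∈E g∈E ∣e∣≡k a∈e b∈e-a c∈e-a-b
                      (p⊆q∧x∉p⇒p⊆q-x (p⊆q∧x∉p⇒p⊆q-x (p⊆q∧x∉p⇒p⊆q-x f∩g⊆e
                        (x∉q⇒x∉p∩q a∉g)) (x∉p⇒x∉p∩q b∉f)) (x∉p⇒x∉p∩q c∉f)))
    where
    f∩g⊆e : f ∩ g ⊆ e
    f∩g⊆e {x} x∈f∩g = decidable-stable (x ∈? e) (λ x∉e → none (x , x∉e , x∈p∩q⁻ f g x∈f∩g))

module AvoidingPair {j} {H : Hypergraph n (4 + j)} (meet : Intersecting (2 + j) H)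
           {e₀} (e₀∈E : e₀ ∈L edges H) where

  open Intersecting-k∸2 {H = H} meet

  Missed : Fin n → Fin n → Set
  Missed a b = Any (λ f → a ∉ f × b ∉ f) (edges H)

  Missed? : ∀ a b → Dec (Missed a b)
  Missed? a b = Any.any? (λ f → ¬? (a ∈? f) ×-dec ¬? (b ∈? f)) (edges H)

  CoversMissing : Fin n → Fin n → Subset n → Set
  CoversMissing a b T = ∀ {f} → f ∈L edges H → a ∉ f → b ∉ f → T ⊆ f

  unmissed-covers : ∀ {a b} T → ¬ Missed a b → CoversMissing a b T
  unmissed-covers T ¬Mab f∈E a∉f b∉f = ⊥-elim (¬Mab (lose f∈E (a∉f , b∉f)))

  ∣e₀-a-b∣ : ∀ {a b} → a ∈ e₀ → b ∈ e₀ - a → ∣ e₀ - a - b ∣ ≡ 2 + j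
  ∣e₀-a-b∣ a∈e₀ b∈e₀-a = +-cancelˡ-≡ 2 _ _ (trans (2+∣p-x-y∣≡∣p∣ a∈e₀ b∈e₀-a) (∣edge∣ e₀∈E))

  e₀-a-b-covers : ∀ {a b} → a ∈ e₀ → b ∈ e₀ - a → CoversMissing a b (e₀ - a - b)
  e₀-a-b-covers a∈e₀ b∈e₀-a f∈E = missing-two⇒rest⊆ e₀∈E f∈E a∈e₀ b∈e₀-a

  -- h misses b and w', so it contains a and w; an edge missing a and w therefore contains
  -- h - a - w, which holds x.
  outside-point∈ : ∀ {a b w w' h x f} → a ∈ e₀ → b ∈ e₀ - a → w ∈ e₀ - a - b → w' ∈ e₀ - a - b - w →
                   h ∈L edges H → b ∉ h → w' ∉ h → x ∈ h → x ∉ e₀ →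
                   f ∈L edges H → a ∉ f → w ∉ f → x ∈ f
  outside-point∈ {a} {b} {w} {w'} {h} {x} a∈e₀ b∈e₀-a w∈e₀-a-b w'∈e₀-a-b-w
                 h∈E b∉h w'∉h x∈h x∉e₀ f∈E a∉f w∉f =
    missing-two⇒rest⊆ h∈E f∈E a∈h w∈h-a a∉f w∉f
      (x∈p∧x≢y⇒x∈p-y (x∈p∧x≢y⇒x∈p-y x∈h (x∉p∧y∈p⇒x≢y x∉e₀ a∈e₀))
                      (x∉p∧y∈p⇒x≢y x∉e₀ w∈e₀))
    where
    w∈e₀-a : w ∈ e₀ - a
    w∈e₀-a = x∈p-y⇒x∈p w∈e₀-a-b
    w∈e₀ : w ∈ e₀
    w∈e₀ = x∈p-y⇒x∈p w∈e₀-a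
    w'∈e₀-a-b : w' ∈ e₀ - a - b
    w'∈e₀-a-b = x∈p-y⇒x∈p w'∈e₀-a-b-w
    w'∈e₀-a : w' ∈ e₀ - a
    w'∈e₀-a = x∈p-y⇒x∈p w'∈e₀-a-b
    e₀-b-w'⊆h : e₀ - b - w' ⊆ h
    e₀-b-w'⊆h = missing-two⇒rest⊆ e₀∈E h∈E (x∈p-y⇒x∈p b∈e₀-a)
                  (x∈p∧x≢y⇒x∈p-y (x∈p-y⇒x∈p w'∈e₀-a) (x∈p-y⇒x≢y w'∈e₀-a-b)) b∉h w'∉h
    a∈h : a ∈ h
    a∈h = e₀-b-w'⊆h (x∈p∧x≢y⇒x∈p-y (x∈p∧x≢y⇒x∈p-y a∈e₀ (≢-sym (x∈p-y⇒x≢y b∈e₀-a)))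
                                    (≢-sym (x∈p-y⇒x≢y w'∈e₀-a)))
    w∈h-a : w ∈ h - a
    w∈h-a = x∈p∧x≢y⇒x∈p-y
              (e₀-b-w'⊆h (x∈p∧x≢y⇒x∈p-y (x∈p∧x≢y⇒x∈p-y w∈e₀ (x∈p-y⇒x≢y w∈e₀-a-b))
                                         (≢-sym (x∈p-y⇒x≢y w'∈e₀-a-b-w))))
              (x∈p-y⇒x≢y w∈e₀-a)

  record PairCover : Set where
    field
      u v    : Fin n
      u∈e₀   : u ∈ e₀
      v∈e₀-u : v ∈ e₀ - u
      R      : List (Subset n)
      sizes  : All (λ T → ∣ T ∣ ≡ 2 + j) R
      length≤ : length R ≤ 3 + j
      covers : ∀ {f} → f ∈L edges H → u ∉ f ⊎ v ∉ f → Any (_⊆ f) R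

  module Pair {u v} (u∈e₀ : u ∈ e₀) (v∈e₀-u : v ∈ e₀ - u) where

    S : Subset n
    S = e₀ - u - v

    v∈e₀ : v ∈ e₀
    v∈e₀ = x∈p-y⇒x∈p v∈e₀-u

    u∈e₀-v : u ∈ e₀ - v
    u∈e₀-v = x∈p∧x≢y⇒x∈p-y u∈e₀ (≢-sym (x∈p-y⇒x≢y v∈e₀-u))

    ∣S∣ : ∣ S ∣ ≡ 2 + j
    ∣S∣ = ∣e₀-a-b∣ u∈e₀ v∈e₀-u

    Bad : Fin n → Set
    Bad w = Missed u w × Missed v w

    Bad? : ∀ w → Dec (Bad w)
    Bad? w = Missed? u w ×-dec Missed? v w

    Good : Fin n → Subset n → Set
    Good w T = ∣ T ∣ ≡ 2 + j × CoversMissing u w T × CoversMissing v w T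

    module _ {w} (w∈S : w ∈ S) where

      w∈e₀-u : w ∈ e₀ - u
      w∈e₀-u = x∈p-y⇒x∈p w∈S

      w∈e₀ : w ∈ e₀
      w∈e₀ = x∈p-y⇒x∈p w∈e₀-u

      w∈e₀-v : w ∈ e₀ - v
      w∈e₀-v = x∈p∧x≢y⇒x∈p-y w∈e₀ (x∈p-y⇒x≢y w∈S)

      good-if-not-bad : ¬ Bad w → Σ (Subset n) (Good w)
      good-if-not-bad ¬bad with Missed? u w
      ... | no ¬Muw = e₀ - v - w , ∣e₀-a-b∣ v∈e₀ w∈e₀-v ,
                      unmissed-covers _ ¬Muw , e₀-a-b-covers v∈e₀ w∈e₀-v
      ... | yes Muw = e₀ - u - w , ∣e₀-a-b∣ u∈e₀ w∈e₀-u ,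
                      e₀-a-b-covers u∈e₀ w∈e₀-u , unmissed-covers _ (λ Mvw → ¬bad (Muw , Mvw))

    double : ∀ {w w'} → w ∈ S → w' ∈ S - w → Bad w' → Σ (Subset n) (Good w)
    double {w} {w'} w∈S w'∈S-w (Muw' , Mvw')
      with g , g∈E , u∉g , w'∉g ← find Muw'
         | h , h∈E , v∉h , w'∉h ← find Mvw'
      with x , x∉e₀ , x∈h , x∈g ← common-point-outside h∈E g∈E (∣edge∣ e₀∈E)
                                     u∈e₀ v∈e₀-u (x∈p-y⇒x∈p w'∈S-w) v∉h w'∉h u∉g
      = (S - w) ∪ ⁅ x ⁆ , ∣T∣ , covers-u , covers-v
      where
      ∣T∣ : ∣ (S - w) ∪ ⁅ x ⁆ ∣ ≡ 2 + j
      ∣T∣ = trans (∣p∪⁅x⁆∣≡suc∣p∣ x∉S-w) (trans (suc∣p-x∣≡∣p∣ w∈S) ∣S∣)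
        where
        x∉S-w : x ∉ S - w
        x∉S-w x∈S-w = x∉e₀ (x∈p-y⇒x∈p (x∈p-y⇒x∈p (x∈p-y⇒x∈p x∈S-w)))
      S≡e₀-v-u : S ≡ e₀ - v - u
      S≡e₀-v-u = p─x─y≡p─y─x e₀ u v
      covers-u : CoversMissing u w ((S - w) ∪ ⁅ x ⁆)
      covers-u f∈E u∉f w∉f =
        p∪⁅x⁆⊆q (⊆-trans (p⊆q⇒p-x⊆q-x (p─q⊆p (e₀ - u) ⁅ v ⁆))
                          (e₀-a-b-covers u∈e₀ (w∈e₀-u w∈S) f∈E u∉f w∉f))
                 (outside-point∈ u∈e₀ v∈e₀-u w∈S w'∈S-w h∈E v∉h w'∉h x∈h x∉e₀ f∈E u∉f w∉f)
      covers-v : CoversMissing v w ((S - w) ∪ ⁅ x ⁆)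
      covers-v f∈E v∉f w∉f =
        p∪⁅x⁆⊆q (⊆-trans (p⊆q⇒p-x⊆q-x (subst (_⊆ e₀ - v) (sym S≡e₀-v-u) (p─q⊆p (e₀ - v) ⁅ u ⁆)))
                          (e₀-a-b-covers v∈e₀ (w∈e₀-v w∈S) f∈E v∉f w∉f))
                 (outside-point∈ v∈e₀ u∈e₀-v (subst (w ∈_) S≡e₀-v-u w∈S)
                    (subst (λ S → w' ∈ S - w) S≡e₀-v-u w'∈S-w) g∈E u∉g w'∉g x∈g x∉e₀ f∈E v∉f w∉f)

    -- An edge missing u or v either contains P, or misses some w ∈ P and then contains the set
    -- chosen for w.
    assemble : (P : Subset n) (R₀ : List (Subset n)) →
               (∀ {w} → w ∈ P → Σ (Subset n) (Good w)) →
               All (λ T → ∣ T ∣ ≡ 2 + j) R₀ → length R₀ + ∣ P ∣ ≡ 3 + j →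
               (∀ {f} → f ∈L edges H → u ∉ f ⊎ v ∉ f → P ⊆ f → Any (_⊆ f) R₀) →
               PairCover
    assemble P R₀ good R₀-sizes length≡ R₀-covers
      with Ts , Ts-sizes , ∣Ts∣≤∣P∣ , Ts-cover
             ← finite-choice (λ T → ∣ T ∣ ≡ 2 + j)
                             (λ w T → CoversMissing u w T × CoversMissing v w T) P good
      = record
      { u∈e₀ = u∈e₀ ; v∈e₀-u = v∈e₀-u
      ; R = R₀ ++ Ts
      ; sizes = ++⁺ R₀-sizes Ts-sizes
      ; length≤ = ≤-trans (≤-reflexive (length-++ R₀))
                          (≤-trans (+-monoʳ-≤ (length R₀) ∣Ts∣≤∣P∣) (≤-reflexive length≡))
      ; covers = covers
      }
      where
      covers : ∀ {f} → f ∈L edges H → u ∉ f ⊎ v ∉ f → Any (_⊆ f) (R₀ ++ Ts)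
      covers {f} f∈E u∉f⊎v∉f with ⊆⊎⊈ P f
      ... | inj₁ P⊆f = ++⁺ˡ (R₀-covers f∈E u∉f⊎v∉f P⊆f)
      ... | inj₂ (w , w∈P , w∉f) = ++⁺ʳ R₀ (Any.map (T⊆f u∉f⊎v∉f) (Ts-cover w∈P))
        where
        T⊆f : u ∉ f ⊎ v ∉ f → ∀ {T} → CoversMissing u w T × CoversMissing v w T → T ⊆ f
        T⊆f (inj₁ u∉f) (covers-u , _) = covers-u f∈E u∉f w∉f
        T⊆f (inj₂ v∉f) (_ , covers-v) = covers-v f∈E v∉f w∉f

    every-bad-has-partner : (∀ {w} → w ∈ S → ∃ λ w' → w' ∈ S - w × Bad w') → PairCover
    every-bad-has-partner partner =
      assemble S (S ∷ []) (λ w∈S → let w' , w'∈S-w , bad = partner w∈S in double w∈S w'∈S-w bad)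
               (∣S∣ ∷ []) (cong suc ∣S∣) (λ _ _ S⊆f → here S⊆f)

    -- As no edge misses both u and v, an edge missing u contains v and hence, if it contains
    -- S - w*, all of e₀ - u - w*; symmetrically for v.
    lone-bad : ¬ Missed u v → ∀ {w*} → w* ∈ S → (∀ {w} → w ∈ S - w* → ¬ Bad w) → PairCover
    lone-bad ¬Muv {w*} w*∈S others-good =
      assemble (S - w*) ((e₀ - u - w*) ∷ (e₀ - v - w*) ∷ [])
               (λ w∈S-w* → good-if-not-bad (x∈p-y⇒x∈p w∈S-w*) (others-good w∈S-w*))
               (∣e₀-a-b∣ u∈e₀ (w∈e₀-u w*∈S) ∷ ∣e₀-a-b∣ v∈e₀ (w∈e₀-v w*∈S) ∷ [])
               (cong suc (trans (suc∣p-x∣≡∣p∣ w*∈S) ∣S∣)) R₀-covers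
      where
      R₀-covers : ∀ {f} → f ∈L edges H → u ∉ f ⊎ v ∉ f → S - w* ⊆ f →
                  Any (_⊆ f) ((e₀ - u - w*) ∷ (e₀ - v - w*) ∷ [])
      R₀-covers {f} f∈E (inj₁ u∉f) S-w*⊆f =
        here (p-x⊆q∧x∈q⇒p⊆q (subst (_⊆ f) (p─x─y≡p─y─x (e₀ - u) v w*) S-w*⊆f)
                            (decidable-stable (v ∈? f) (λ v∉f → ¬Muv (lose f∈E (u∉f , v∉f)))))
      R₀-covers {f} f∈E (inj₂ v∉f) S-w*⊆f =
        there (here (p-x⊆q∧x∈q⇒p⊆q (subst (_⊆ f) S-w*≡e₀-v-w*-u S-w*⊆f)
                                   (decidable-stable (u ∈? f) (λ u∉f → ¬Muv (lose f∈E (u∉f , v∉f))))))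
        where
        S-w*≡e₀-v-w*-u : S - w* ≡ e₀ - v - w* - u
        S-w*≡e₀-v-w*-u = trans (cong (_- w*) (p─x─y≡p─y─x e₀ u v)) (p─x─y≡p─y─x (e₀ - v) u w*)

    unmissed-pair : ¬ Missed u v → PairCover
    unmissed-pair ¬Muv with any? (λ w* → w* ∈? S ×-dec ¬? (any? (λ w → w ∈? S - w* ×-dec Bad? w)))
    ... | yes (w* , w*∈S , no-other-bad) =
      lone-bad ¬Muv w*∈S (λ w∈S-w* bad → no-other-bad (_ , w∈S-w* , bad))
    ... | no  no-lone-bad = every-bad-has-partner partner
      where
      partner : ∀ {w} → w ∈ S → ∃ λ w' → w' ∈ S - w × Bad w'
      partner {w} w∈S = decidable-stable (any? (λ w' → w' ∈? S - w ×-dec Bad? w'))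
                                         (λ no-other-bad → no-lone-bad (w , w∈S , no-other-bad))

    all-missed : (∀ {a b} → a ∈ e₀ → b ∈ e₀ - a → Missed a b) → PairCover
    all-missed missed = every-bad-has-partner partner
      where
      partner : ∀ {w} → w ∈ S → ∃ λ w' → w' ∈ S - w × Bad w'
      partner {w} w∈S =
        let w' , w'∈S-w = nonempty (S - w) (subst (0 <_) (sym ∣S-w∣) (s≤s z≤n))
            w'∈S = x∈p-y⇒x∈p w'∈S-w
        in  w' , w'∈S-w , missed u∈e₀ (w∈e₀-u w'∈S) , missed v∈e₀ (w∈e₀-v w'∈S)
        where
        ∣S-w∣ : ∣ S - w ∣ ≡ 1 + j
        ∣S-w∣ = suc-injective (trans (suc∣p-x∣≡∣p∣ w∈S) ∣S∣)

  -- If every pair of e₀ is missed by some edge, every w ∈ S is bad, and k ≥ 4 provides a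
  -- second bad vertex in S - w.
  pair-cover : PairCover
  pair-cover with any? (λ a → any? (λ b → a ∈? e₀ ×-dec b ∈? e₀ - a ×-dec ¬? (Missed? a b)))
  ... | yes (u , v , u∈e₀ , v∈e₀-u , ¬Muv) = Pair.unmissed-pair u∈e₀ v∈e₀-u ¬Muv
  ... | no  none
    with u , u∈e₀ ← nonempty e₀ (subst (0 <_) (sym (∣edge∣ e₀∈E)) (s≤s z≤n))
    with ∣e₀-u∣ ← suc-injective (trans (suc∣p-x∣≡∣p∣ u∈e₀) (∣edge∣ e₀∈E))
    with v , v∈e₀-u ← nonempty (e₀ - u) (subst (0 <_) (sym ∣e₀-u∣) (s≤s z≤n))
    = Pair.all-missed u∈e₀ v∈e₀-u
        (λ a∈e₀ b∈e₀-a → decidable-stable (Missed? _ _) (λ ¬Mab → none (_ , _ , a∈e₀ , b∈e₀-a , ¬Mab)))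

module Link {k} {u v : Fin n} (u≢v : u ≢ v) (H : Hypergraph n (2 + k)) where

  private
    ∋uv? : (f : Subset n) → Dec (u ∈ f × v ∈ f)
    ∋uv? f = u ∈? f ×-dec v ∈? f

  link-edges : List (Subset n)
  link-edges = map (λ f → f - u - v) (filter ∋uv? (edges H))

  ∈-link⁺ : ∀ {f} → f ∈L edges H → u ∈ f → v ∈ f → f - u - v ∈L link-edges
  ∈-link⁺ f∈E u∈f v∈f = ∈-map⁺ (λ f → f - u - v) (∈-filter⁺ ∋uv? f∈E (u∈f , v∈f))

  ∈-link⁻ : ∀ {h} → h ∈L link-edges → ∃ λ f → f ∈L edges H × u ∈ f × v ∈ f × h ≡ f - u - v
  ∈-link⁻ h∈ with f , f∈filter , refl ← ∈-map⁻ (λ f → f - u - v) h∈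
    with f∈E , u∈f , v∈f ← ∈-filter⁻ ∋uv? f∈filter = f , f∈E , u∈f , v∈f , refl

  v∈f-u : ∀ {f} → v ∈ f → v ∈ f - u
  v∈f-u v∈f = x∈p∧x≢y⇒x∈p-y v∈f (≢-sym u≢v)

  link : Hypergraph n k
  link = record { edges = link-edges ; uniform = All.tabulate ∣link-edge∣ }
    where
    ∣link-edge∣ : ∀ {h} → h ∈L link-edges → ∣ h ∣ ≡ k
    ∣link-edge∣ h∈ with f , f∈E , u∈f , v∈f , refl ← ∈-link⁻ h∈ =
      +-cancelˡ-≡ 2 _ _ (trans (2+∣p-x-y∣≡∣p∣ u∈f (v∈f-u v∈f)) (All.lookup (uniform H) f∈E))

  link-intersecting : ∀ {t} → Intersecting (2 + t) H → Intersecting t link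
  link-intersecting meet h∈ h'∈
    with f , f∈E , u∈f , v∈f , refl ← ∈-link⁻ h∈
       | g , g∈E , u∈g , v∈g , refl ← ∈-link⁻ h'∈ =
    ≤-trans (+-cancelˡ-≤ 2 _ _ (≤-trans (meet f∈E g∈E) (≤-reflexive (sym ∣f∩g∣))))
            (p⊆q⇒∣p∣≤∣q∣ f∩g-u-v⊆)
    where
    ∣f∩g∣ : 2 + ∣ f ∩ g - u - v ∣ ≡ ∣ f ∩ g ∣
    ∣f∩g∣ = 2+∣p-x-y∣≡∣p∣ (x∈p∩q⁺ (u∈f , u∈g)) (v∈f-u (x∈p∩q⁺ (v∈f , v∈g)))
    f∩g-u-v⊆ : f ∩ g - u - v ⊆ (f - u - v) ∩ (g - u - v)
    f∩g-u-v⊆ y∈ with y∈f , y∈g ← x∈p∩q⁻ f g (x∈p-y⇒x∈p (x∈p-y⇒x∈p y∈)) =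
      x∈p∩q⁺ (minus-u-v y∈f , minus-u-v y∈g)
      where
      minus-u-v : ∀ {e} → _ ∈ e → _ ∈ e - u - v
      minus-u-v y∈e = x∈p∧x≢y⇒x∈p-y (x∈p∧x≢y⇒x∈p-y y∈e (x∈p-y⇒x≢y (x∈p-y⇒x∈p y∈))) (x∈p-y⇒x≢y y∈)

  -- Members of the link cover that contain u or v cover no link edge; the others are
  -- enlarged by u and v.
  lift-cover : ∀ {m C} → IsCover m link C →
               Σ (List (Subset n)) λ C' → All (λ c → ∣ c ∣ ≡ 2 + m) C' × length C' ≤ length C ×
                 (∀ {f} → f ∈L edges H → u ∈ f → v ∈ f → Any (_⊆ f) C')
  lift-cover {m} {C} isCover =
    map lift (filter avoids? C) , All.tabulate ∣lifted∣ ,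
    ≤-trans (≤-reflexive (length-map lift (filter avoids? C))) (length-filter avoids? C) ,
    covers
    where
    avoids? : (c : Subset n) → Dec (u ∉ c × v ∉ c)
    avoids? c = ¬? (u ∈? c) ×-dec ¬? (v ∈? c)
    lift : Subset n → Subset n
    lift c = (c ∪ ⁅ u ⁆) ∪ ⁅ v ⁆
    ∣lifted∣ : ∀ {c'} → c' ∈L map lift (filter avoids? C) → ∣ c' ∣ ≡ 2 + m
    ∣lifted∣ c'∈ with c , c∈filter , refl ← ∈-map⁻ lift c'∈
      with c∈C , u∉c , v∉c ← ∈-filter⁻ avoids? c∈filter =
      trans (∣p∪⁅x⁆∣≡suc∣p∣ v∉c∪u)
            (cong suc (trans (∣p∪⁅x⁆∣≡suc∣p∣ u∉c) (cong suc (All.lookup (IsCover.msets isCover) c∈C))))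
      where
      v∉c∪u : v ∉ c ∪ ⁅ u ⁆
      v∉c∪u v∈ with x∈p∪q⁻ c ⁅ u ⁆ v∈
      ... | inj₁ v∈c = v∉c v∈c
      ... | inj₂ v∈⁅u⁆ = u≢v (sym (x∈⁅y⁆⇒x≡y u v∈⁅u⁆))
    covers : ∀ {f} → f ∈L edges H → u ∈ f → v ∈ f → Any (_⊆ f) (map lift (filter avoids? C))
    covers f∈E u∈f v∈f
      with c , c∈C , c⊆f-u-v ← find (All.lookup (IsCover.covers isCover) (∈-link⁺ f∈E u∈f v∈f)) =
      lose (∈-map⁺ lift (∈-filter⁺ avoids? c∈C (u∉c , v∉c)))
           (p∪⁅x⁆⊆q (p∪⁅x⁆⊆q (λ y∈c → x∈p-y⇒x∈p (x∈p-y⇒x∈p (c⊆f-u-v y∈c))) u∈f) v∈f)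
      where
      u∉c : u ∉ c
      u∉c u∈c = x∉p-x (x∈p-y⇒x∈p (c⊆f-u-v u∈c))
      v∉c : v ∉ c
      v∉c v∈c = x∉p-x (c⊆f-u-v v∈c)

star-cover : ∀ {k} {H : Hypergraph n k} {e₀} → Intersecting 1 H → e₀ ∈L edges H → τ≤ 1 H ∣ e₀ ∣
star-cover {e₀ = e₀} meet e₀∈E
  with Ts , Ts-sizes , ∣Ts∣≤∣e₀∣ , Ts-cover
         ← finite-choice (λ T → ∣ T ∣ ≡ 1) (λ x T → ∀ {f} → x ∈ f → T ⊆ f) e₀
                         (λ {x} _ → ⁅ x ⁆ , ∣⁅x⁆∣≡1 x , x∈p⇒⁅x⁆⊆p)
  = Ts , record { msets = Ts-sizes ; covers = All.tabulate covers } , ∣Ts∣≤∣e₀∣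
  where
  covers : ∀ {f} → f ∈L _ → Any (_⊆ f) Ts
  covers {f} f∈E with x , x∈e₀∩f ← nonempty (e₀ ∩ f) (meet e₀∈E f∈E)
    with x∈e₀ , x∈f ← x∈p∩q⁻ e₀ f x∈e₀∩f = Any.map (λ covers-x {y} → covers-x x∈f {y}) (Ts-cover x∈e₀)

ceilSq/4-step : ∀ j → ceilSq/4 (4 + j) ≡ 3 + j + ceilSq/4 (2 + j)
ceilSq/4-step j = begin
  ((4 + j) * (4 + j) + 3) / 4                   ≡⟨ cong (_/ 4) (square-step j) ⟩
  (m + (3 + j) * 4) / 4                         ≡⟨ +-distrib-/-∣ʳ m {d = 4} (divides (3 + j) refl) ⟩
  ceilSq/4 (2 + j) + (3 + j) * 4 / 4            ≡⟨ cong (ceilSq/4 (2 + j) +_) (m*n/n≡m (3 + j) 4) ⟩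
  ceilSq/4 (2 + j) + (3 + j)                    ≡⟨ +-comm (ceilSq/4 (2 + j)) (3 + j) ⟩
  3 + j + ceilSq/4 (2 + j)                      ∎
  where
  open ≡-Reasoning
  m : ℕ
  m = (2 + j) * (2 + j) + 3
  square-step : ∀ j → (4 + j) * (4 + j) + 3 ≡ (2 + j) * (2 + j) + 3 + (3 + j) * 4
  square-step = solve-∀

cover-by-cases : ∀ {k m} {H : Hypergraph n k} {u v} (R C : List (Subset n)) →
                 All (λ c → ∣ c ∣ ≡ m) R → All (λ c → ∣ c ∣ ≡ m) C →
                 (∀ {f} → f ∈L edges H → u ∉ f ⊎ v ∉ f → Any (_⊆ f) R) →
                 (∀ {f} → f ∈L edges H → u ∈ f → v ∈ f → Any (_⊆ f) C) →
                 IsCover m H (R ++ C)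
cover-by-cases {u = u} {v} R C R-sizes C-sizes R-covers C-covers =
  record { msets = ++⁺ R-sizes C-sizes ; covers = All.tabulate covered }
  where
  covered : ∀ {f} → f ∈L _ → Any (_⊆ f) (R ++ C)
  covered {f} f∈E with u ∈? f | v ∈? f
  ... | yes u∈f | yes v∈f = ++⁺ʳ R (C-covers f∈E u∈f v∈f)
  ... | no  u∉f | _       = ++⁺ˡ (R-covers f∈E (inj₁ u∉f))
  ... | yes _   | no  v∉f = ++⁺ˡ (R-covers f∈E (inj₂ v∉f))

cover : ∀ j (H : Hypergraph n (2 + j)) {e₀} → e₀ ∈L edges H → Intersecting j H →
        τ≤ j H (ceilSq/4 (2 + j))
cover {n} zero H _ _ =
  ∅ ∷ [] , record { msets = ∣⊥∣≡0 n ∷ [] ; covers = All.tabulate (λ _ → here (⊆-min _)) } , ≤-refl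
cover (suc zero) H e₀∈E meet =
  subst (τ≤ 1 H) (All.lookup (uniform H) e₀∈E) (star-cover meet e₀∈E)
cover (suc (suc j)) H e₀∈E meet =
  let open AvoidingPair {H = H} meet e₀∈E using (module PairCover; pair-cover)
      open PairCover pair-cover
      open Link (≢-sym (x∈p-y⇒x≢y v∈e₀-u)) H
      C , isCover , ∣C∣≤ = cover j link (∈-link⁺ e₀∈E u∈e₀ (x∈p-y⇒x∈p v∈e₀-u)) (link-intersecting meet)
      C' , C'-sizes , ∣C'∣≤∣C∣ , C'-covers = lift-cover isCover
  in  R ++ C' , cover-by-cases R C' sizes C'-sizes covers C'-covers ,
      (begin
        length (R ++ C')            ≡⟨ length-++ R ⟩
        length R + length C'        ≤⟨ +-mono-≤ length≤ (≤-trans ∣C'∣≤∣C∣ ∣C∣≤) ⟩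
        3 + j + ceilSq/4 (2 + j)    ≡⟨ ceilSq/4-step j ⟨
        ceilSq/4 (4 + j)            ∎)
  where open ≤-Reasoning

ν≤1⇒intersecting : ∀ {k m} {H : Hypergraph n k} → (∀ M → IsMatching m H M → length M ≤ 1) → m ≤ k →
                   Intersecting m H
ν≤1⇒intersecting {m = m} {H} ν≤1 m≤k {f} {g} f∈E g∈E with m ≤? ∣ f ∩ g ∣
... | yes m≤∣f∩g∣ = m≤∣f∩g∣
... | no  m≰∣f∩g∣ with ≡-dec _≟ᵇ_ f g
...   | yes refl = subst (m ≤_) (sym (trans (cong ∣_∣ (∩-idem f)) (All.lookup (uniform H) f∈E))) m≤k
...   | no  f≢g  = ⊥-elim (1+n≰n (ν≤1 (f ∷ g ∷ []) record
          { inH      = f∈E ∷ g∈E ∷ []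
          ; distinct = (f≢g ∷ []) ∷ [] ∷ []
          ; small    = (≰⇒> m≰∣f∩g∣ ∷ []) ∷ [] ∷ []
          }))

theorem4 : (k : ℕ) → 3 ≤ k → (n : ℕ) → (H : Hypergraph n k) →
    ν≡1 (k ∸ 2) H → τ≤ (k ∸ 2) H (ceilSq/4 k)
theorem4 (suc (suc j)) (s≤s (s≤s _)) n H ((e₀ ∷ [] , matching , _) , ν≤1) =
  cover j H (All.head (IsMatching.inH matching)) (ν≤1⇒intersecting ν≤1 (m∸n≤m (2 + j) 2))
theorem4 (suc (suc j)) _ n H (([] , _ , ()) , _)
theorem4 (suc (suc j)) _ n H ((_ ∷ _ ∷ _ , _ , ()) , _)
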